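{- There exists an absolute constant $k''$ such that for all natural numbers $k \geq k''$ the following holds: if $n$ is a natural number coprime to each of the first $k$ primes $p_1, \ldots, p_k$ and $\sigma(n)/n \geq \frac{4}{3}$, then $n > p_1^2 p_2^2 \cdots p_k^2$.
   Context: $p_i$ denotes the $i$-th prime ($p_1 = 2, p_2 = 3, \ldots$); $\sigma(n)$ is the sum of the positive divisors of $n$. -}

module Defs where

open import Data.Nat using (ℕ; zero; suc; _+_; _*_; _^_; _!)
open import Data.Nat.Divisibility using (_∣?_)
open import Data.Nat.Primality using (prime?)
open import Data.List using (List; filter; map; upTo)
open import Data.Nat.ListAction using (sum)
open import Relation.Nullary using (yes; no)

divisors : ℕ → List ℕ
divisors n = filter (λ d → d ∣? n) (map suc (upTo n))

σ : ℕ → ℕ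
σ n = sum (divisors n)

-- search for the least prime in [m, m + fuel); fallback value never used
-- in practice since fuel = n ! + 1 suffices (Euclid)
searchPrime : ℕ → ℕ → ℕ
searchPrime fuel@zero m = m
searchPrime (suc fuel) m with prime? m
... | yes _ = m
... | no _  = searchPrime fuel (suc m)

nextPrime : ℕ → ℕ
nextPrime n = searchPrime (n !) (suc n)

-- p i = i-th prime, 1-indexed: p 1 = 2, p 2 = 3, ...  (p 0 = 1 by convention, unused)
p : ℕ → ℕ
p zero = 1
p (suc zero) = 2
p (suc (suc i)) = nextPrime (p (suc i))

primeSqProd : ℕ → ℕ
primeSqProd zero = 1
primeSqProd (suc k) = primeSqProd k * (p (suc k) ^ 2)

{-# OPTIONS --safe #-}
-- Write n as a product of r primes. Coprimality to p₁, …, p_k makes each of them at least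
-- s = p_k + 1, so n ≥ s^r. Every proper divisor of n divides n/q for some prime factor q, so
-- σ(n) ≤ n + Σ_q σ(n/q), and induction on r gives (s − r) σ(n) ≤ s n; with σ(n)/n ≥ 4/3 this
-- forces s ≤ 4r, hence n⁴ ≥ s^s. On the other hand the primes in (x/2, x] divide the binomial
-- coefficient C(x, ⌈x/2⌉) ≤ 2^x, which gives p₁⋯p_k ≤ 16^(p_k) and so n ≤ p₁²⋯p_k² ≤ 16^(2 p_k).
-- The two bounds are incompatible as soon as s ≥ 2^32.
module Submission where

open import Defs
open import Data.Nat using (ℕ; zero; suc; _+_; _*_; _∸_; _^_; _≤_; _<_; z≤n; s≤s; NonZero; >-nonZero; ≢-nonZero; ≢-nonZero⁻¹; nonTrivial⇒n>1; _!; ⌊_/2⌋; ⌈_/2⌉)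
open import Data.Nat.Properties
open import Data.Nat.Divisibility
open import Data.Nat.Coprimality using (Coprime)
open import Data.Nat.Combinatorics using (_C_; k![n∸k]!∣n!; nCk+nC[k+1]≡[n+1]C[k+1])
open import Data.Nat.Combinatorics.Specification using (nCk≡n!/k![n-k]!)
open import Data.Nat.DivMod using (m/n*n≡m)
open import Data.Nat.Induction using (<-rec)
open import Data.Nat.Solver using (module +-*-Solver)
open import Data.Nat.Primality
open import Data.Nat.Primality.Factorisation using (factorise; factorisationHasAllPrimeFactors; module PrimeFactorisation)
open import Data.Nat.ListAction using (sum; product)
open import Data.Nat.ListAction.Properties using (sum-++; ∈⇒∣product)
open import Data.List using (List; []; _∷_; _++_; [_]; filter; map; upTo; length)
open import Data.List.Properties using (upTo-∷ʳ; map-++; filter-++; filter-accept; filter-reject)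
open import Data.List.Relation.Unary.All as All using (All; []; _∷_)
open import Data.List.Relation.Unary.Any using (here; there)
open import Data.List.Membership.Propositional using (_∈_)
open import Data.Product using (∃-syntax; _×_; _,_; proj₁; proj₂)
open import Data.Sum using (inj₁; inj₂)
open import Data.Empty using (⊥; ⊥-elim)
open import Relation.Nullary using (¬_; yes; no)
open import Relation.Binary.PropositionalEquality hiding ([_])
open import Algebra.Properties.CommutativeSemigroup +-commutativeSemigroup using () renaming (interchange to +-interchange)
open import Algebra.Properties.CommutativeSemigroup *-commutativeSemigroup using () renaming (x∙yz≈y∙xz to *-left-comm)

sumTo : (ℕ → ℕ) → ℕ → ℕ
sumTo f zero    = 0
sumTo f (suc N) = sumTo f N + f (suc N)

sumTo-mono : ∀ {f g} N → (∀ d → 1 ≤ d → d ≤ N → f d ≤ g d) → sumTo f N ≤ sumTo g N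
sumTo-mono zero    f≤g = z≤n
sumTo-mono (suc N) f≤g =
  +-mono-≤ (sumTo-mono N λ d 1≤d d≤N → f≤g d 1≤d (m≤n⇒m≤1+n d≤N)) (f≤g (suc N) (s≤s z≤n) ≤-refl)

sumTo-+ : ∀ f g N → sumTo (λ d → f d + g d) N ≡ sumTo f N + sumTo g N
sumTo-+ f g zero    = refl
sumTo-+ f g (suc N) rewrite sumTo-+ f g N = +-interchange (sumTo f N) (sumTo g N) (f (suc N)) (g (suc N))

divisorTerm : ℕ → ℕ → ℕ
divisorTerm m d with d ∣? m
... | yes _ = d
... | no  _ = 0

divisorTerm-∣ : ∀ {m d} → d ∣ m → divisorTerm m d ≡ d
divisorTerm-∣ {m} {d} d∣m with d ∣? m
... | yes _  = refl
... | no d∤m = ⊥-elim (d∤m d∣m)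

divisorTerm-> : ∀ {m d} → .{{NonZero m}} → m < d → divisorTerm m d ≡ 0
divisorTerm-> {m} {d} m<d with d ∣? m
... | yes d∣m = ⊥-elim (<⇒≱ m<d (∣⇒≤ d∣m))
... | no  _   = refl

σ≡sumTo : ∀ m → σ m ≡ sumTo (divisorTerm m) m
σ≡sumTo m = go m
  where
  P? = λ d → d ∣? m
  go : ∀ N → sum (filter P? (map suc (upTo N))) ≡ sumTo (divisorTerm m) N
  go zero    = refl
  go (suc N) = begin
      sum (filter P? (map suc (upTo (suc N))))
    ≡⟨ cong (λ l → sum (filter P? (map suc l))) (sym (upTo-∷ʳ N)) ⟩
      sum (filter P? (map suc (upTo N ++ [ N ])))
    ≡⟨ cong (λ l → sum (filter P? l)) (map-++ suc (upTo N) [ N ]) ⟩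
      sum (filter P? (map suc (upTo N) ++ [ suc N ]))
    ≡⟨ cong sum (filter-++ P? (map suc (upTo N)) [ suc N ]) ⟩
      sum (filter P? (map suc (upTo N)) ++ filter P? [ suc N ])
    ≡⟨ sum-++ (filter P? (map suc (upTo N))) (filter P? [ suc N ]) ⟩
      sum (filter P? (map suc (upTo N))) + sum (filter P? [ suc N ])
    ≡⟨ cong₂ _+_ (go N) last ⟩
      sumTo (divisorTerm m) N + divisorTerm m (suc N) ∎
    where
    open ≡-Reasoning
    last : sum (filter P? [ suc N ]) ≡ divisorTerm m (suc N)
    last with suc N ∣? m
    ... | yes d∣m = trans (cong sum (filter-accept P? {xs = []} d∣m)) (+-identityʳ (suc N))
    ... | no  d∤m = cong sum (filter-reject P? {xs = []} d∤m)

sumTo-divisorTerm : ∀ {m N} → .{{NonZero m}} → m ≤ N → sumTo (divisorTerm m) N ≡ σ m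
sumTo-divisorTerm {m} {N} m≤N with m≤n⇒m<n∨m≡n m≤N
... | inj₂ refl = sym (σ≡sumTo m)
sumTo-divisorTerm {m} {suc N} _ | inj₁ (s≤s m≤N) = begin
    sumTo (divisorTerm m) N + divisorTerm m (suc N) ≡⟨ cong₂ _+_ (sumTo-divisorTerm m≤N) (divisorTerm-> (s≤s m≤N)) ⟩
    σ m + 0                                         ≡⟨ +-identityʳ (σ m) ⟩
    σ m                                             ∎
  where open ≡-Reasoning

data Removal {A : Set} : List A → A → List A → Set where
  here  : ∀ {x xs} → Removal (x ∷ xs) x xs
  there : ∀ {y x xs ys} → Removal xs x ys → Removal (y ∷ xs) x (y ∷ ys)

-- One term g x ys for each position of xs, where x is the entry there and ys the rest.
sumRemovals : {A : Set} → List A → (A → List A → ℕ) → ℕ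
sumRemovals []       g = 0
sumRemovals (x ∷ xs) g = g x xs + sumRemovals xs (λ y ys → g y (x ∷ ys))

module _ {A : Set} where

  ∈⇒Removal : ∀ {x : A} {xs} → x ∈ xs → ∃[ ys ] Removal xs x ys
  ∈⇒Removal (here refl) = _ , here
  ∈⇒Removal (there x∈xs) with ∈⇒Removal x∈xs
  ... | ys , r = _ ∷ ys , there r

  Removal-length : ∀ {x : A} {xs ys} → Removal xs x ys → length xs ≡ suc (length ys)
  Removal-length here      = refl
  Removal-length (there r) = cong suc (Removal-length r)

  Removal-All : ∀ {P : A → Set} {x xs ys} → Removal xs x ys → All P xs → P x × All P ys
  Removal-All here      (px ∷ pxs) = px , pxs
  Removal-All (there r) (py ∷ pxs) with Removal-All r pxs
  ... | px , pys = px , py ∷ pys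

  sumRemovals-mono : ∀ xs {g h : A → List A → ℕ} →
                     (∀ {x ys} → Removal xs x ys → g x ys ≤ h x ys) →
                     sumRemovals xs g ≤ sumRemovals xs h
  sumRemovals-mono []       g≤h = z≤n
  sumRemovals-mono (x ∷ xs) g≤h = +-mono-≤ (g≤h here) (sumRemovals-mono xs (λ r → g≤h (there r)))

  sumRemovals-≤-length* : ∀ xs {g : A → List A → ℕ} {b} →
                          (∀ {x ys} → Removal xs x ys → g x ys ≤ b) →
                          sumRemovals xs g ≤ length xs * b
  sumRemovals-≤-length* []       g≤b = z≤n
  sumRemovals-≤-length* (x ∷ xs) g≤b = +-mono-≤ (g≤b here) (sumRemovals-≤-length* xs (λ r → g≤b (there r)))

  term≤sumRemovals : ∀ {xs x ys} (g : A → List A → ℕ) → Removal xs x ys → g x ys ≤ sumRemovals xs g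
  term≤sumRemovals g here      = m≤m+n _ _
  term≤sumRemovals g (there r) = ≤-trans (term≤sumRemovals _ r) (m≤n+m _ _)

  *-distribˡ-sumRemovals : ∀ c xs (g : A → List A → ℕ) →
                           c * sumRemovals xs g ≡ sumRemovals xs (λ x ys → c * g x ys)
  *-distribˡ-sumRemovals c []       g = *-zeroʳ c
  *-distribˡ-sumRemovals c (x ∷ xs) g =
    trans (*-distribˡ-+ c (g x xs) _) (cong (c * g x xs +_) (*-distribˡ-sumRemovals c xs _))

  sumTo-sumRemovals : ∀ xs (F : A → List A → ℕ → ℕ) N →
                      sumTo (λ d → sumRemovals xs (λ x ys → F x ys d)) N ≡ sumRemovals xs (λ x ys → sumTo (F x ys) N)
  sumTo-sumRemovals []       F zero    = refl
  sumTo-sumRemovals []       F (suc N) = cong (_+ 0) (sumTo-sumRemovals [] F N)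
  sumTo-sumRemovals (x ∷ xs) F N =
    trans (sumTo-+ (F x xs) _ N) (cong (sumTo (F x xs) N +_) (sumTo-sumRemovals xs _ N))

Removal-product : ∀ {xs x ys} → Removal xs x ys → product xs ≡ x * product ys
Removal-product here = refl
Removal-product {y ∷ _} {x} {_ ∷ ys} (there r) rewrite Removal-product r = *-left-comm y x (product ys)

prime⇒>1 : ∀ {q} → Prime q → 1 < q
prime⇒>1 {q} pq = nonTrivial⇒n>1 q {{prime⇒nonTrivial pq}}

∃-prime-divisor : ∀ {e} → 1 < e → ∃[ t ] Prime t × t ∣ e
∃-prime-divisor {suc e} 1<e with factorise (suc e)
... | record { factors = [] ; isFactorisation = eq } = ⊥-elim (<⇒≢ 1<e (sym eq))
... | record { factors = t ∷ ts ; isFactorisation = eq ; factorsPrime = pt ∷ _ } =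
  t , pt , subst (t ∣_) (sym eq) (m∣m*n (product ts))

proper-divisor⇒∣removal : ∀ {Q d} → All Prime Q → d ∣ product Q → d < product Q →
                          ∃[ q ] ∃[ R ] Removal Q q R × d ∣ product R
proper-divisor⇒∣removal {Q} {d} primeQ (divides e Q≡ed) d<Q = t , R , r , divides e′ R≡e′d
  where
  1<e : 1 < e
  1<e = *-cancelʳ-< d 1 e (subst (_< e * d) (sym (*-identityˡ d)) (subst (d <_) Q≡ed d<Q))
  tp = ∃-prime-divisor 1<e
  t = proj₁ tp
  pt = proj₁ (proj₂ tp)
  t∣e = proj₂ (proj₂ tp)
  t∈Q : t ∈ Q
  t∈Q = factorisationHasAllPrimeFactors pt (subst (t ∣_) (sym Q≡ed) (∣-trans t∣e (m∣m*n d))) primeQ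
  R = proj₁ (∈⇒Removal t∈Q)
  r = proj₂ (∈⇒Removal t∈Q)
  e′ = quotient t∣e
  R≡e′d : product R ≡ e′ * d
  R≡e′d = *-cancelˡ-≡ (product R) (e′ * d) t {{prime⇒nonZero pt}} (begin
    t * product R ≡⟨ sym (Removal-product r) ⟩
    product Q     ≡⟨ Q≡ed ⟩
    e * d         ≡⟨ cong (_* d) (trans (m∣n⇒n≡quotient*m t∣e) (*-comm e′ t)) ⟩
    t * e′ * d    ≡⟨ *-assoc t e′ d ⟩
    t * (e′ * d)  ∎)
    where open ≡-Reasoning

σ-suc : ∀ m → σ (suc m) ≡ sumTo (divisorTerm (suc m)) m + suc m
σ-suc m = trans (σ≡sumTo (suc m)) (cong (sumTo (divisorTerm (suc m)) m +_) (divisorTerm-∣ ∣-refl))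

removal-product< : ∀ {Q q R} → All Prime Q → Removal Q q R → product R < product Q
removal-product< {Q} {q} {R} primeQ r = begin-strict
    product R     <⟨ m<m*n (product R) q {{productOfPrimes≢0 primeR}} (prime⇒>1 pq) ⟩
    product R * q ≡⟨ *-comm (product R) q ⟩
    q * product R ≡⟨ sym (Removal-product r) ⟩
    product Q     ∎
  where
  open ≤-Reasoning
  pq = proj₁ (Removal-All r primeQ)
  primeR = proj₂ (Removal-All r primeQ)

σ-product-≤ : ∀ {Q} → All Prime Q → σ (product Q) ≤ product Q + sumRemovals Q (λ _ R → σ (product R))
σ-product-≤ {Q} primeQ with product Q in Q≡n | productOfPrimes≥1 primeQ
... | suc m | _ = begin
    σ n                                                         ≡⟨ σ-suc m ⟩
    sumTo (divisorTerm n) m + n                                 ≤⟨ +-monoˡ-≤ n (sumTo-mono m covered) ⟩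
    sumTo (λ d → sumRemovals Q (λ _ R → divisorTerm (product R) d)) m + n
                                                                ≡⟨ cong (_+ n) (sumTo-sumRemovals Q (λ _ R → divisorTerm (product R)) m) ⟩
    sumRemovals Q (λ _ R → sumTo (divisorTerm (product R)) m) + n
                                                                ≤⟨ +-monoˡ-≤ n (sumRemovals-mono Q (λ r → ≤-reflexive (removalσ r))) ⟩
    sumRemovals Q (λ _ R → σ (product R)) + n                   ≡⟨ +-comm _ n ⟩
    n + sumRemovals Q (λ _ R → σ (product R))                   ∎
  where
  open ≤-Reasoning
  n = suc m
  covered : ∀ d → 1 ≤ d → d ≤ m → divisorTerm n d ≤ sumRemovals Q (λ _ R → divisorTerm (product R) d)
  covered d _ d≤m with d ∣? n
  ... | no  _   = z≤n
  ... | yes d∣n with proper-divisor⇒∣removal primeQ (subst (d ∣_) (sym Q≡n) d∣n) (subst (d <_) (sym Q≡n) (s≤s d≤m))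
  ...   | q , R , r , d∣R = subst (_≤ _) (divisorTerm-∣ d∣R) (term≤sumRemovals (λ _ R → divisorTerm (product R) d) r)
  removalσ : ∀ {q R} → Removal Q q R → sumTo (divisorTerm (product R)) m ≡ σ (product R)
  removalσ r = sumTo-divisorTerm {{productOfPrimes≢0 (proj₂ (Removal-All r primeQ))}}
                 (≤-pred (subst (_ <_) Q≡n (removal-product< primeQ r)))

-- c + r ≡ s stands for c = s − r; the cofactors have one prime fewer, so the recursive call uses c + 1.
σ-product-bound : ∀ {s} c r → c + r ≡ s → ∀ {Q} → All Prime Q → All (s ≤_) Q → length Q ≤ r →
                  c * σ (product Q) ≤ s * product Q
σ-product-bound {s} c r c+r≡s {[]} _ _ _ = *-monoˡ-≤ 1 (subst (c ≤_) c+r≡s (m≤m+n c r))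
σ-product-bound {s} c (suc r) c+1+r≡s {Q@(_ ∷ _)} primeQ bigQ len≤1+r = begin
    c * σ n                                            ≤⟨ *-monoʳ-≤ c (σ-product-≤ primeQ) ⟩
    c * (n + sumRemovals Q (λ _ R → σ (product R)))    ≡⟨ *-distribˡ-+ c n _ ⟩
    c * n + c * sumRemovals Q (λ _ R → σ (product R))  ≡⟨ cong (c * n +_) (*-distribˡ-sumRemovals c Q (λ _ R → σ (product R))) ⟩
    c * n + sumRemovals Q (λ _ R → c * σ (product R))  ≤⟨ +-monoʳ-≤ (c * n) (sumRemovals-≤-length* Q each) ⟩
    c * n + length Q * n                               ≤⟨ +-monoʳ-≤ (c * n) (*-monoˡ-≤ n len≤1+r) ⟩
    c * n + suc r * n                                  ≡⟨ sym (*-distribʳ-+ n c (suc r)) ⟩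
    (c + suc r) * n                                    ≡⟨ cong (_* n) c+1+r≡s ⟩
    s * n                                              ∎
  where
  open ≤-Reasoning
  n = product Q
  each : ∀ {q R} → Removal Q q R → c * σ (product R) ≤ n
  each {q} {R} rem = begin
    c * σ (product R)     ≤⟨ *-monoˡ-≤ (σ (product R)) (n≤1+n c) ⟩
    suc c * σ (product R) ≤⟨ σ-product-bound (suc c) r (trans (sym (+-suc c r)) c+1+r≡s)
                               (proj₂ (Removal-All rem primeQ)) (proj₂ (Removal-All rem bigQ))
                               (≤-pred (subst (_≤ suc r) (Removal-length rem) len≤1+r)) ⟩
    s * product R         ≤⟨ *-monoˡ-≤ (product R) (proj₁ (Removal-All rem bigQ)) ⟩
    q * product R         ≡⟨ sym (Removal-product rem) ⟩
    n                     ∎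

abundant⇒≤4*length : ∀ {s Q} → All Prime Q → All (s ≤_) Q →
                     4 * product Q ≤ 3 * σ (product Q) → s ≤ 4 * length Q
abundant⇒≤4*length {s} {Q} primeQ bigQ abundant with length Q ≤? s
... | no  r≰s = ≤-trans (<⇒≤ (≰⇒> r≰s)) (m≤n*m (length Q) 4)
... | yes r≤s = +-cancelˡ-≤ (3 * s) s (4 * r) (begin
    3 * s + s      ≡⟨ +-comm (3 * s) s ⟩
    4 * s          ≡⟨ cong (4 *_) (sym (m∸n+n≡m r≤s)) ⟩
    4 * (c + r)    ≡⟨ *-distribˡ-+ 4 c r ⟩
    4 * c + 4 * r  ≤⟨ +-monoˡ-≤ (4 * r) 4c≤3s ⟩
    3 * s + 4 * r  ∎)
  where
  open ≤-Reasoning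
  r = length Q
  n = product Q
  c = s ∸ r
  4c≤3s : 4 * c ≤ 3 * s
  4c≤3s = *-cancelʳ-≤ (4 * c) (3 * s) n {{productOfPrimes≢0 primeQ}} (begin
    4 * c * n        ≡⟨ *-assoc 4 c n ⟩
    4 * (c * n)      ≡⟨ *-left-comm 4 c n ⟩
    c * (4 * n)      ≤⟨ *-monoʳ-≤ c abundant ⟩
    c * (3 * σ n)    ≡⟨ *-left-comm c 3 (σ n) ⟩
    3 * (c * σ n)    ≤⟨ *-monoʳ-≤ 3 (σ-product-bound c r (m∸n+n≡m r≤s) primeQ bigQ ≤-refl) ⟩
    3 * (s * n)      ≡⟨ sym (*-assoc 3 s n) ⟩
    3 * s * n        ∎)

NoPrimeBetween : ℕ → ℕ → Set
NoPrimeBetween a b = ∀ {t} → a ≤ t → t < b → ¬ Prime t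

searchPrime-least : ∀ fuel {m q} → Prime q → m ≤ q → q < m + fuel →
                    Prime (searchPrime fuel m) × m ≤ searchPrime fuel m × NoPrimeBetween m (searchPrime fuel m)
searchPrime-least zero {m} _ m≤q q<m+0 = ⊥-elim (<⇒≱ q<m+0 (subst (_≤ _) (sym (+-identityʳ m)) m≤q))
searchPrime-least (suc fuel) {m} {q} pq m≤q q<m+1+fuel with prime? m
... | yes pm = pm , ≤-refl , λ m≤t t<m → ⊥-elim (<⇒≱ t<m m≤t)
... | no ¬pm with m ≟ q
...   | yes refl = ⊥-elim (¬pm pq)
...   | no m≢q with searchPrime-least fuel pq (≤∧≢⇒< m≤q m≢q) (subst (q <_) (+-suc m fuel) q<m+1+fuel)
...     | pr , 1+m≤r , gap = pr , ≤-trans (n≤1+n m) 1+m≤r , gap′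
  where
  gap′ : NoPrimeBetween m _
  gap′ {t} m≤t t<r with m ≟ t
  ... | yes refl = ¬pm
  ... | no  m≢t  = gap (≤∧≢⇒< m≤t m≢t) t<r

≤⇒∣! : ∀ {t m} → 1 ≤ t → t ≤ m → t ∣ m !
≤⇒∣! {suc t} _ t≤m = ∣-trans (m∣m*n (t !)) (m≤n⇒m!∣n! t≤m)

prime∣!⇒≤ : ∀ {q} → Prime q → ∀ m → q ∣ m ! → q ≤ m
prime∣!⇒≤ pq zero    q∣1 = ⊥-elim (<⇒≢ (prime⇒>1 pq) (sym (∣1⇒≡1 q∣1)))
prime∣!⇒≤ pq (suc m) q∣m! with euclidsLemma (suc m) (m !) pq q∣m!
... | inj₁ q∣1+m = ∣⇒≤ q∣1+m
... | inj₂ q∣m!  = m≤n⇒m≤1+n (prime∣!⇒≤ pq m q∣m!)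

euclid : ∀ m → ∃[ q ] Prime q × m < q × q ≤ m ! + 1
euclid m = t , pt , m<t , ∣⇒≤ {{>-nonZero (<⇒≤ 1<N)}} t∣N
  where
  N = m ! + 1
  1<N : 1 < N
  1<N = +-monoˡ-≤ 1 (1≤n! m)
  tp = ∃-prime-divisor 1<N
  t = proj₁ tp
  pt = proj₁ (proj₂ tp)
  t∣N = proj₂ (proj₂ tp)
  m<t : m < t
  m<t with m <? t
  ... | yes m<t = m<t
  ... | no  m≮t = ⊥-elim (<⇒≢ (prime⇒>1 pt)
    (sym (∣1⇒≡1 (∣m+n∣m⇒∣n t∣N (≤⇒∣! (<⇒≤ (prime⇒>1 pt)) (≮⇒≥ m≮t))))))

nextPrime-least : ∀ {m} → 1 ≤ m → Prime (nextPrime m) × m < nextPrime m × NoPrimeBetween (suc m) (nextPrime m)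
nextPrime-least {m} 1≤m with euclid m
... | q , pq , m<q , q≤m!+1 = searchPrime-least (m !) pq m<q (s≤s (begin
    q         ≤⟨ q≤m!+1 ⟩
    m ! + 1   ≡⟨ +-comm (m !) 1 ⟩
    1 + m !   ≤⟨ +-monoˡ-≤ (m !) 1≤m ⟩
    m + m !   ∎))
  where open ≤-Reasoning

p-step : ∀ j → Prime (p (suc j)) × p j < p (suc j) × NoPrimeBetween (suc (p j)) (p (suc j))
p-step zero    = prime[2] , s≤s (s≤s z≤n) , λ 2≤t t<2 → ⊥-elim (<⇒≱ t<2 2≤t)
p-step (suc j) = nextPrime-least (<⇒≤ (prime⇒>1 (proj₁ (p-step j))))

p-prime : ∀ j → Prime (p (suc j))
p-prime j = proj₁ (p-step j)

p-< : ∀ j → p j < p (suc j)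
p-< j = proj₁ (proj₂ (p-step j))

n<p : ∀ k → k < p k
n<p zero    = s≤s z≤n
n<p (suc k) = <-≤-trans (s≤s (n<p k)) (p-< k)

prime≤p⇒∃index : ∀ k {q} → Prime q → q ≤ p k → ∃[ i ] 1 ≤ i × i ≤ k × q ≡ p i
prime≤p⇒∃index zero    pq q≤1 = ⊥-elim (<⇒≱ (prime⇒>1 pq) q≤1)
prime≤p⇒∃index (suc j) {q} pq q≤p₁₊ⱼ with q ≤? p j
... | yes q≤pⱼ with prime≤p⇒∃index j pq q≤pⱼ
...   | i , 1≤i , i≤j , q≡pᵢ = i , 1≤i , m≤n⇒m≤1+n i≤j , q≡pᵢ
prime≤p⇒∃index (suc j) {q} pq q≤p₁₊ⱼ | no q≰pⱼ with q ≟ p (suc j)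
... | yes q≡p₁₊ⱼ = suc j , s≤s z≤n , ≤-refl , q≡p₁₊ⱼ
... | no  q≢p₁₊ⱼ = ⊥-elim (proj₂ (proj₂ (p-step j)) (≰⇒> q≰pⱼ) (≤∧≢⇒< q≤p₁₊ⱼ q≢p₁₊ⱼ) pq)

C≤2^ : ∀ n k → n C k ≤ 2 ^ n
C≤2^ zero    zero    = ≤-refl
C≤2^ zero    (suc k) = z≤n
C≤2^ (suc n) zero    = m^n>0 2 (suc n)
C≤2^ (suc n) (suc k) = begin
    suc n C suc k      ≡⟨ sym (nCk+nC[k+1]≡[n+1]C[k+1] n k) ⟩
    n C k + n C suc k  ≤⟨ +-mono-≤ (C≤2^ n k) (C≤2^ n (suc k)) ⟩
    2 ^ n + 2 ^ n      ≡⟨ cong (2 ^ n +_) (sym (+-identityʳ (2 ^ n))) ⟩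
    2 ^ suc n          ∎
  where open ≤-Reasoning

n!≡nCk*k!*[n∸k]! : ∀ {n k} → k ≤ n → n ! ≡ (n C k) * (k ! * (n ∸ k) !)
n!≡nCk*k!*[n∸k]! {n} {k} k≤n = sym (trans (cong (_* (k ! * (n ∸ k) !)) (nCk≡n!/k![n-k]! k≤n))
                                           (m/n*n≡m {{_}} (k![n∸k]!∣n! k≤n)))

nCk≢0 : ∀ {n k} → k ≤ n → NonZero (n C k)
nCk≢0 {n} {k} k≤n = ≢-nonZero λ C≡0 → ≢-nonZero⁻¹ (n !) {{n !≢0}}
  (trans (n!≡nCk*k!*[n∸k]! k≤n) (cong (_* (k ! * (n ∸ k) !)) C≡0))

prime∣C : ∀ {x a q} → Prime q → a ≤ x → a < q → x ∸ a < q → q ≤ x → q ∣ x C a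
prime∣C {x} {a} {q} pq a≤x a<q x∸a<q q≤x
  with euclidsLemma (x C a) (a ! * (x ∸ a) !) pq
         (subst (q ∣_) (n!≡nCk*k!*[n∸k]! a≤x) (≤⇒∣! (<⇒≤ (prime⇒>1 pq)) q≤x))
... | inj₁ q∣C = q∣C
... | inj₂ q∣a![x∸a]! with euclidsLemma (a !) ((x ∸ a) !) pq q∣a![x∸a]!
...   | inj₁ q∣a!     = ⊥-elim (<⇒≱ a<q (prime∣!⇒≤ pq a q∣a!))
...   | inj₂ q∣[x∸a]! = ⊥-elim (<⇒≱ x∸a<q (prime∣!⇒≤ pq (x ∸ a) q∣[x∸a]!))

primorial : ℕ → ℕ
primorial zero    = 1
primorial (suc k) = primorial k * p (suc k)

primeSqProd≡primorial² : ∀ k → primeSqProd k ≡ primorial k * primorial k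
primeSqProd≡primorial² zero    = refl
primeSqProd≡primorial² (suc k) rewrite primeSqProd≡primorial² k = regroup (primorial k) (p (suc k))
  where
  open +-*-Solver
  regroup : ∀ a b → a * a * b ^ 2 ≡ a * b * (a * b)
  regroup = solve 2 (λ a b → a :* a :* b :^ 2 := a :* b :* (a :* b)) refl

prime>p⇒∤primorial : ∀ k {q} → Prime q → p k < q → ¬ q ∣ primorial k
prime>p⇒∤primorial zero    pq _ q∣1 = <⇒≢ (prime⇒>1 pq) (sym (∣1⇒≡1 q∣1))
prime>p⇒∤primorial (suc k) pq p<q q∣P*p with euclidsLemma (primorial k) (p (suc k)) pq q∣P*p
... | inj₁ q∣P = prime>p⇒∤primorial k pq (<-trans (p-< k) p<q) q∣P
... | inj₂ q∣p = <⇒≱ p<q (∣⇒≤ {{prime⇒nonZero (p-prime k)}} q∣p)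

primorial-split : ∀ {x a} → 1 ≤ a → a ≤ x → x ∸ a ≤ a → ∀ k → p k ≤ x →
                  ∃[ j ] p j ≤ a × ∃[ R ] primorial k ≡ primorial j * R × R ∣ x C a
primorial-split 1≤a _ _ zero _ = 0 , 1≤a , 1 , refl , 1∣ _
primorial-split {x} {a} 1≤a a≤x x∸a≤a (suc k) q≤x with p (suc k) ≤? a
... | yes q≤a = suc k , q≤a , 1 , sym (*-identityʳ _) , 1∣ _
... | no  q≰a with primorial-split 1≤a a≤x x∸a≤a k (≤-trans (<⇒≤ (p-< k)) q≤x)
...   | j , pⱼ≤a , R , Pₖ≡PⱼR , R∣C = j , pⱼ≤a , R * q , Pₖq≡PⱼRq , Rq∣C
  where
  q = p (suc k)
  pq = p-prime k
  a<q = ≰⇒> q≰a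
  t = quotient R∣C
  C≡Rt : x C a ≡ R * t
  C≡Rt = trans (m∣n⇒n≡quotient*m R∣C) (*-comm t R)
  q∣t : q ∣ t
  q∣t with euclidsLemma R t pq (subst (q ∣_) C≡Rt (prime∣C pq a≤x a<q (≤-<-trans x∸a≤a a<q) q≤x))
  ... | inj₂ q∣t = q∣t
  ... | inj₁ q∣R = ⊥-elim (prime>p⇒∤primorial k pq (p-< k)
                     (∣-trans q∣R (subst (R ∣_) (sym Pₖ≡PⱼR) (n∣m*n (primorial j)))))
  Rq∣C : R * q ∣ x C a
  Rq∣C = subst (R * q ∣_) (sym C≡Rt) (*-monoʳ-∣ R q∣t)
  Pₖq≡PⱼRq : primorial k * q ≡ primorial j * (R * q)
  Pₖq≡PⱼRq = trans (cong (_* q) Pₖ≡PⱼR) (*-assoc (primorial j) R q)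

n≤4*⌊n/2⌋ : ∀ n → 2 ≤ n → n ≤ 4 * ⌊ n /2⌋
n≤4*⌊n/2⌋ 1 (s≤s ())
n≤4*⌊n/2⌋ 2 _ = m≤m+n 2 2
n≤4*⌊n/2⌋ 3 _ = n≤1+n 3
n≤4*⌊n/2⌋ (suc (suc n@(suc (suc _)))) _ =
  subst (2 + n ≤_) (sym (*-suc 4 ⌊ n /2⌋)) (+-mono-≤ (m≤m+n 2 2) (n≤4*⌊n/2⌋ n (s≤s (s≤s z≤n))))

primorial≤16^ : ∀ x {k} → p k ≤ x → primorial k ≤ 16 ^ x
primorial≤16^ = <-rec (λ x → ∀ {k} → p k ≤ x → primorial k ≤ 16 ^ x) step
  where
  step : ∀ x → (∀ {y} → y < x → ∀ {k} → p k ≤ y → primorial k ≤ 16 ^ y) → ∀ {k} → p k ≤ x → primorial k ≤ 16 ^ x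
  step x _   {zero}  _   = m^n>0 16 x
  step x rec {suc k} q≤x = bound (primorial-split 1≤a a≤x (≤-trans (≤-reflexive x∸a≡b) b≤a) (suc k) q≤x)
    where
    a = ⌈ x /2⌉
    b = ⌊ x /2⌋
    b+a≡x = ⌊n/2⌋+⌈n/2⌉≡n x
    2≤x = ≤-trans (prime⇒>1 (p-prime k)) q≤x
    b≤a = ⌊n/2⌋≤⌈n/2⌉ x
    1≤b : 1 ≤ b
    1≤b = ⌊n/2⌋-mono 2≤x
    1≤a = ≤-trans 1≤b b≤a
    a<x : a < x
    a<x = subst (a <_) b+a≡x (m<n+m a 1≤b)
    a≤x = <⇒≤ a<x
    x∸a≡b : x ∸ a ≡ b
    x∸a≡b = trans (cong (_∸ a) (sym b+a≡x)) (m+n∸n≡m b a)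
    bound : ∃[ j ] p j ≤ a × ∃[ R ] primorial (suc k) ≡ primorial j * R × R ∣ x C a → primorial (suc k) ≤ 16 ^ x
    bound (j , pⱼ≤a , R , P≡PⱼR , R∣C) = begin
      primorial (suc k)  ≡⟨ P≡PⱼR ⟩
      primorial j * R    ≤⟨ *-mono-≤ (rec a<x {j} pⱼ≤a) (∣⇒≤ {{nCk≢0 a≤x}} R∣C) ⟩
      16 ^ a * (x C a)   ≤⟨ *-monoʳ-≤ (16 ^ a) (C≤2^ x a) ⟩
      16 ^ a * 2 ^ x     ≤⟨ *-monoʳ-≤ (16 ^ a) (^-monoʳ-≤ 2 (n≤4*⌊n/2⌋ x 2≤x)) ⟩
      16 ^ a * 2 ^ (4 * b) ≡⟨ cong (16 ^ a *_) (sym (^-*-assoc 2 4 b)) ⟩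
      16 ^ a * 16 ^ b    ≡⟨ sym (^-distribˡ-+-* 16 a b) ⟩
      16 ^ (a + b)       ≡⟨ cong (16 ^_) (trans (+-comm a b) b+a≡x) ⟩
      16 ^ x             ∎
      where open ≤-Reasoning

s^length≤product : ∀ {s} Q → All (s ≤_) Q → s ^ length Q ≤ product Q
s^length≤product []      []            = ≤-refl
s^length≤product (_ ∷ Q) (s≤q ∷ s≤Q) = *-mono-≤ s≤q (s^length≤product Q s≤Q)

coprime-to-first⇒factor> : ∀ k {n q} → (∀ i → 1 ≤ i → i ≤ k → Coprime n (p i)) → Prime q → q ∣ n → p k < q
coprime-to-first⇒factor> k {n} {q} coprime pq q∣n with p k <? q
... | yes pₖ<q = pₖ<q
... | no  pₖ≮q with prime≤p⇒∃index k pq (≮⇒≥ pₖ≮q)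
...   | i , 1≤i , i≤k , q≡pᵢ = ⊥-elim (<⇒≢ (prime⇒>1 pq) (sym (coprime i 1≤i i≤k (q∣n , subst (q ∣_) q≡pᵢ ∣-refl))))

large-power-clash : ∀ {P r n} → 2 ^ 32 ≤ suc P → suc P ≤ 4 * r → suc P ^ r ≤ n → n ≤ 16 ^ (P + P) → ⊥
large-power-clash {P} {r} {n} 2^32≤s s≤4r s^r≤n n≤16^2P = <-irrefl refl (begin-strict
    2 ^ (32 * s)               ≡⟨ sym (^-*-assoc 2 32 s) ⟩
    (2 ^ 32) ^ s               ≤⟨ ^-monoˡ-≤ s 2^32≤s ⟩
    s ^ s                      ≤⟨ ^-monoʳ-≤ s s≤4r ⟩
    s ^ (4 * r)                ≡⟨ cong (s ^_) (*-comm 4 r) ⟩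
    s ^ (r * 4)                ≡⟨ sym (^-*-assoc s r 4) ⟩
    (s ^ r) ^ 4                ≤⟨ ^-monoˡ-≤ 4 s^r≤n ⟩
    n ^ 4                      ≤⟨ ^-monoˡ-≤ 4 n≤16^2P ⟩
    (16 ^ (P + P)) ^ 4         ≡⟨ ^-*-assoc 16 (P + P) 4 ⟩
    16 ^ ((P + P) * 4)         ≡⟨ ^-*-assoc 2 4 ((P + P) * 4) ⟩
    2 ^ (4 * ((P + P) * 4))    ≡⟨ cong (2 ^_) (exponent P) ⟩
    2 ^ (32 * P)               <⟨ ^-monoʳ-< 2 (s≤s (s≤s z≤n)) (*-monoʳ-< 32 (n<1+n P)) ⟩
    2 ^ (32 * s)               ∎)
  where
  open ≤-Reasoning
  open +-*-Solver
  s = suc P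
  exponent : ∀ P → 4 * ((P + P) * 4) ≡ 32 * P
  exponent = solve 1 (λ P → con 4 :* ((P :+ P) :* con 4) := con 32 :* P) refl

lemma4p18 : ∃[ k″ ] ((k : ℕ) → k″ ≤ k → (n : ℕ) → 1 ≤ n
    → ((i : ℕ) → 1 ≤ i → i ≤ k → Coprime n (p i))
    → 4 * n ≤ 3 * σ n
    → primeSqProd k < n)
lemma4p18 = 2 ^ 32 , main
  where
  main : ∀ k → 2 ^ 32 ≤ k → ∀ n → 1 ≤ n → (∀ i → 1 ≤ i → i ≤ k → Coprime n (p i)) →
         4 * n ≤ 3 * σ n → primeSqProd k < n
  main k 2^32≤k n 1≤n coprime abundant = ≰⇒> λ n≤Π → large-power-clash {r = r} 2^32≤s s≤4r s^r≤n (≤-trans n≤Π Π≤16^2P)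
    where
    open PrimeFactorisation (factorise n {{>-nonZero 1≤n}}) renaming (isFactorisation to n≡Q)
    P = p k
    r = length factors
    2^32≤s : 2 ^ 32 ≤ suc P
    2^32≤s = ≤-trans 2^32≤k (<⇒≤ (<-≤-trans (n<p k) (n≤1+n P)))
    bigFactors : All (suc P ≤_) factors
    bigFactors = All.tabulate λ {q} q∈Q →
      coprime-to-first⇒factor> k coprime (All.lookup factorsPrime q∈Q) (subst (q ∣_) (sym n≡Q) (∈⇒∣product q∈Q))
    s≤4r : suc P ≤ 4 * r
    s≤4r = abundant⇒≤4*length factorsPrime bigFactors (subst (λ m → 4 * m ≤ 3 * σ m) n≡Q abundant)
    s^r≤n : suc P ^ r ≤ n
    s^r≤n = subst (suc P ^ r ≤_) (sym n≡Q) (s^length≤product factors bigFactors)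
    Π≤16^2P : primeSqProd k ≤ 16 ^ (P + P)
    Π≤16^2P = begin
      primeSqProd k               ≡⟨ primeSqProd≡primorial² k ⟩
      primorial k * primorial k   ≤⟨ *-mono-≤ (primorial≤16^ P {k} ≤-refl) (primorial≤16^ P {k} ≤-refl) ⟩
      16 ^ P * 16 ^ P             ≡⟨ sym (^-distribˡ-+-* 16 P P) ⟩
      16 ^ (P + P)                ∎
      where open ≤-Reasoning
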